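{- Let $\tau$ be a similarity type, let $h:\mathcal L\to\mathcal L^*$ be a homomorphism of normal lattice expansions of type $\tau$ (with corresponding operators $f_\sigma$, $f^*_\sigma$), and let $\mathfrak F=(X,I,Y,(R_\sigma)_{\sigma\in\tau})$ and $\mathfrak F^*=(X^*,I^*,Y^*,(S_\sigma)_{\sigma\in\tau})$ be the canonical frames of $\mathcal L$ and $\mathcal L^*$. For a filter $x^*$ and an ideal $y^*$ of $\mathcal L^*$ define $p(x^*)=h^{ -1}[x^*]$ and $q(y^*)=h^{ -1}[y^*]$. Then $\pi=(p,q):\mathfrak F^*\to\mathfrak F$ satisfies: (MAx1) for all $x'\in X^*,y'\in Y^*$: $x'I^*y'$ implies $p(x')Iq(y')$; (MAx2) for all $x\in X,y'\in Y^*$: if $xIq(y')$ then there is $x'\in X^*$ with $x\le p(x')$ and $x'I^*y'$; (MAx3) for all $x'\in X^*,y\in Y$: if $p(x')Iy$ then there is $y'\in Y^*$ with $y\le q(y')$ and $x'I^*y'$; (MAx4) for every $\sigma=(i_{n+1};i_1\cdots i_n)\in\tau$, every tuple $\vec u$ with $u_j\in Z_{i_j}$ and every $v\in Z^*_{i_{n+1}}$: $\pi(v)R_\sigma\vec u$ iff there is a tuple $\vec w$ with $w_j\in Z^*_{i_j}$, $u_j\le\pi(w_j)$ for all $j$, and $vS_\sigma\vec w$.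
   Context: For a bounded lattice $\mathcal L$ put $\mathcal L^1=\mathcal L$ and $\mathcal L^\partial$ the opposite lattice. An $n$-ary operation $f$ on $\mathcal L$ is a normal lattice operator of distribution type $(i_1,\ldots,i_n;i_{n+1})\in\{1,\partial\}^{n+1}$ if, as a map $\mathcal L^{i_1}\times\cdots\times\mathcal L^{i_n}\to\mathcal L^{i_{n+1}}$, it distributes over finite joins in each argument place. A similarity type $\tau$ is a sequence of distribution types; a normal lattice expansion of type $\tau$ is a bounded lattice with one such operator $f_\sigma$ for each type in $\tau$; homomorphisms are bounded lattice homomorphisms commuting with all operators. Canonical frame of $\mathcal L$: $X$ = set of filters, $Y$ = set of ideals of $\mathcal L$, $xIy$ iff $x\cap y=\emptyset$ (so $x\perp y$ iff $x\cap y\ne\emptyset$). Sorts $Z_1=X$, $Z_\partial=Y$. For an operator $f$ of type $(i_1,\ldots,i_n;i_{n+1})$ and a tuple $\vec u$ with $u_j\in Z_{i_j}$ (a filter if $i_j=1$, an ideal if $i_j=\partial$), $\widehat f(\vec u)$ is the filter (if $i_{n+1}=1$) or ideal (if $i_{n+1}=\partial$) generated by $\{f(\vec a): a_j\in u_j\text{ for all }j\}$; the canonical relation $R\subseteq Z_{i_{n+1}}\times\prod_jZ_{i_j}$ is $wR\vec u$ iff $\widehat f(\vec u)\subseteq w$. The preorder $\le$ of a frame: for filters $x\le z$ iff $\{x\}^\perp\subseteq\{z\}^\perp$, for ideals $y\le v$ iff ${}^\perp\{y\}\subseteq{}^\perp\{v\}$, where $U^\perp=\{y: x\perp y\ \forall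 x\in U\}$, ${}^\perp V=\{x: x\perp y\ \forall y\in V\}$. $\pi(w)$ denotes $p(w)$ or $q(w)$ according to the sort of $w$. -}

module Defs where

open import Level using (Level; _⊔_; suc)
open import Data.Nat using (ℕ)
open import Data.Fin using (Fin)
open import Data.List using (List; foldr)
open import Data.List.Relation.Unary.All using (All)
open import Data.Product using (Σ; ∃; _×_; _,_)
open import Data.Empty using () renaming (⊥ to Empty)
open import Data.Vec.Functional using (updateAt)
open import Function using (const)
open import Relation.Unary using (Pred)
open import Relation.Binary.PropositionalEquality using (_≡_)
open import Relation.Binary.Lattice.Bundles using (BoundedLattice)

-- Sorts: 1 (the lattice itself) and ∂ (the opposite lattice)

data Sort : Set where
  one  : Sort
  dual : Sort

record DType : Set where
  constructor dtype
  field
    arity : ℕ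
    args  : Fin arity → Sort
    out   : Sort
open DType public

module _ {ℓ : Level} (L : BoundedLattice ℓ ℓ ℓ) where
  open BoundedLattice L

  joinOf : Sort → Carrier → Carrier → Carrier
  joinOf one  a b = a ∨ b
  joinOf dual a b = a ∧ b

  botOf : Sort → Carrier
  botOf one  = ⊥
  botOf dual = ⊤

  record IsNormalOperator (d : DType) (f : (Fin (arity d) → Carrier) → Carrier)
         : Set ℓ where
    field
      cong  : ∀ {a b : Fin (arity d) → Carrier} →
              (∀ j → a j ≈ b j) → f a ≈ f b
      distrib : ∀ (a : Fin (arity d) → Carrier) (j : Fin (arity d)) (b c : Carrier) →
              f (updateAt a j (const (joinOf (args d j) b c)))
                ≈ joinOf (out d) (f (updateAt a j (const b)))
                                 (f (updateAt a j (const c)))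
      normal : ∀ (a : Fin (arity d) → Carrier) (j : Fin (arity d)) →
              f (updateAt a j (const (botOf (args d j)))) ≈ botOf (out d)

  record IsFilter (F : Pred Carrier ℓ) : Set ℓ where
    field
      top∈  : F ⊤
      up    : ∀ {a b} → a ≤ b → F a → F b
      meet∈ : ∀ {a b} → F a → F b → F (a ∧ b)

  record IsIdeal (J : Pred Carrier ℓ) : Set ℓ where
    field
      bot∈  : J ⊥
      down  : ∀ {a b} → b ≤ a → J a → J b
      join∈ : ∀ {a b} → J a → J b → J (a ∨ b)

  Filter : Set (suc ℓ)
  Filter = Σ (Pred Carrier ℓ) IsFilter

  Ideal : Set (suc ℓ)
  Ideal = Σ (Pred Carrier ℓ) IsIdeal

  Irel : Pred Carrier ℓ → Pred Carrier ℓ → Set ℓ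
  Irel x y = ∀ a → x a → y a → Empty

  Perp : Pred Carrier ℓ → Pred Carrier ℓ → Set ℓ
  Perp x y = ∃ λ a → x a × y a

  Z : Sort → Set (suc ℓ)
  Z one  = Filter
  Z dual = Ideal

  elemsOf : (s : Sort) → Z s → Pred Carrier ℓ
  elemsOf one  (F , _) = F
  elemsOf dual (J , _) = J

  LeqOf : Sort → Pred Carrier ℓ → Pred Carrier ℓ → Set (suc ℓ)
  LeqOf one  x z = ∀ (y : Ideal)  → Perp x (elemsOf dual y) → Perp z (elemsOf dual y)
  LeqOf dual y v = ∀ (x : Filter) → Perp (elemsOf one x) y → Perp (elemsOf one x) v

  Generated : Sort → Pred Carrier ℓ → Pred Carrier ℓ
  Generated one  S z = ∃ λ (cs : List Carrier) → All S cs × foldr _∧_ ⊤ cs ≤ z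
  Generated dual S z = ∃ λ (cs : List Carrier) → All S cs × z ≤ foldr _∨_ ⊥ cs

  fhat : (d : DType) (f : (Fin (arity d) → Carrier) → Carrier) →
         ((j : Fin (arity d)) → Z (args d j)) → Pred Carrier ℓ
  fhat d f u = Generated (out d) λ c →
    Σ (Fin (arity d) → Carrier) λ a →
      (∀ j → elemsOf (args d j) (u j) (a j)) × (c ≡ f a)

  CanR : (d : DType) (f : (Fin (arity d) → Carrier) → Carrier) →
         Pred Carrier ℓ → ((j : Fin (arity d)) → Z (args d j)) → Set ℓ
  CanR d f w u = ∀ c → fhat d f u c → w c

record NLE {k : Level} {K : Set k} (τ : K → DType) (ℓ : Level)
       : Set (k ⊔ suc ℓ) where
  field
    lat   : BoundedLattice ℓ ℓ ℓ
  open BoundedLattice lat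
  field
    op       : (σ : K) → (Fin (arity (τ σ)) → Carrier) → Carrier
    isNormal : (σ : K) → IsNormalOperator lat (τ σ) (op σ)
open NLE public

record Hom {k : Level} {K : Set k} {τ : K → DType} {ℓ : Level}
           (L L* : NLE τ ℓ) : Set (k ⊔ ℓ) where
  module A = BoundedLattice (lat L)
  module B = BoundedLattice (lat L*)
  field
    fun     : A.Carrier → B.Carrier
    cong    : ∀ {a b} → a A.≈ b → fun a B.≈ fun b
    pres-∨  : ∀ a b → fun (a A.∨ b) B.≈ (fun a B.∨ fun b)
    pres-∧  : ∀ a b → fun (a A.∧ b) B.≈ (fun a B.∧ fun b)
    pres-⊤  : fun A.⊤ B.≈ B.⊤
    pres-⊥  : fun A.⊥ B.≈ B.⊥
    pres-op : ∀ (σ : K) (a : Fin (arity (τ σ)) → A.Carrier) →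
              fun (op L σ a) B.≈ op L* σ (λ j → fun (a j))
open Hom public

-- preimage h⁻¹[w]; this is both p (on filters) and q (on ideals)
preimage : {k : Level} {K : Set k} {τ : K → DType} {ℓ : Level}
           {L L* : NLE τ ℓ} (h : Hom L L*) →
           Pred (BoundedLattice.Carrier (lat L*)) ℓ →
           Pred (BoundedLattice.Carrier (lat L)) ℓ
preimage h w a = w (fun h a)

πmap : {k : Level} {K : Set k} {τ : K → DType} {ℓ : Level}
       {L L* : NLE τ ℓ} (h : Hom L L*) (s : Sort) →
       Z (lat L*) s → Pred (BoundedLattice.Carrier (lat L)) ℓ
πmap h s w = preimage h (elemsOf _ s w)

{-# OPTIONS --safe #-}
-- p and q are preimages under a bounded lattice homomorphism, hence again a filter and an
-- ideal, and on filters (ideals) of L the frame preorder is inclusion, as testing it against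
-- principal ideals (filters) shows. The filters and ideals of L* required by (MAx2)-(MAx4) are
-- the upward, resp. downward, closures of images under h. For (MAx4) this works because a
-- normal operator is monotone in each argument, hence jointly monotone, so f*(b⃗) lies above
-- f*(h a⃗) = h(f a⃗) as soon as each b_j lies above some h(a_j) with a_j ∈ u_j. Reading an
-- ideal of L as a filter of the opposite lattice L^∂ lets each argument be made once for both
-- sorts.
module Submission where

open import Defs hiding (cong)
open import Level using (Level; _⊔_)
import Data.Nat as ℕ
open import Data.Fin using (Fin; zero; suc)
open import Data.Product using (Σ; ∃; _×_; _,_; proj₁; proj₂)
open import Data.List using ([]; _∷_; foldr)
open import Data.List.Relation.Unary.All as All using (All; []; _∷_)
import Data.Vec.Functional as Vector
open import Data.Vec.Functional using (Vector; updateAt)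
open import Function using (id; const; flip; _∘_)
open import Relation.Binary.PropositionalEquality as ≡ using (_≡_)
open import Relation.Binary.Core using (Rel)
open import Relation.Binary.Definitions using (Reflexive)
open import Relation.Binary.Bundles using (Setoid; Preorder)
open import Relation.Binary.Lattice.Bundles using (BoundedLattice)
open import Relation.Binary.Lattice.Structures using (IsBoundedLattice)
open import Relation.Binary.Lattice.Properties.Lattice using (∧-∨-isLattice)
open import Relation.Binary.Lattice.Properties.JoinSemilattice using (x≤y⇒x∨y≈y)
open import Relation.Binary.Lattice.Properties.MeetSemilattice using (y≤x⇒x∧y≈y)
import Relation.Binary.Reasoning.Preorder as PreorderReasoning
open import Relation.Unary using (Pred; _⊆_)
open import Function.Bundles using (_⇔_; mk⇔)

updateAt-const-cong : ∀ {a r : Level} {A : Set a} {R : Rel A r} → Reflexive R →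
  ∀ {n} (g : Vector A n) j {x y} → R x y →
  ∀ i → R (updateAt g j (const x) i) (updateAt g j (const y) i)
updateAt-const-cong R-refl g zero    x∼y zero    = x∼y
updateAt-const-cong R-refl g zero    x∼y (suc i) = R-refl
updateAt-const-cong R-refl g (suc j) x∼y zero    = R-refl
updateAt-const-cong {R = R} R-refl g (suc j) x∼y (suc i) =
  updateAt-const-cong {R = R} R-refl (Vector.tail g) j x∼y i

module _ {a b ℓ₁ ℓ₂ ℓ₃ r : Level} (S : Setoid a ℓ₁) (P : Preorder b ℓ₂ ℓ₃) where
  open Setoid S using (_≈_) renaming (Carrier to A; refl to ≈-refl)
  open Preorder P using (_≲_; reflexive) renaming (Carrier to B; _≈_ to _≈ᴮ_)
  open PreorderReasoning P

  Congruent : ∀ {n} → (Vector A n → B) → Set (a ⊔ ℓ₁ ⊔ ℓ₂)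
  Congruent f = ∀ {g g′} → (∀ i → g i ≈ g′ i) → f g ≈ᴮ f g′

  MonotoneInEachArgument : ∀ {n} → (Fin n → Rel A r) → (Vector A n → B) → Set (a ⊔ r ⊔ ℓ₃)
  MonotoneInEachArgument _⊑_ f = ∀ g j {x y} → _⊑_ j x y →
    f (updateAt g j (const x)) ≲ f (updateAt g j (const y))

  monotoneInEachArgument⇒monotone : ∀ {n} (_⊑_ : Fin n → Rel A r) (f : Vector A n → B) →
    Congruent f → MonotoneInEachArgument _⊑_ f →
    ∀ {g g′} → (∀ i → _⊑_ i (g i) (g′ i)) → f g ≲ f g′
  monotoneInEachArgument⇒monotone {ℕ.zero} _⊑_ f f-cong f-mono g⊑g′ =
    reflexive (f-cong λ ())
  -- Raise the first argument, then recurse with it frozen; every f-cong step compares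
  -- vectors that agree definitionally at each index.
  monotoneInEachArgument⇒monotone {ℕ.suc n} _⊑_ f f-cong f-mono {g} {g′} g⊑g′ = begin
    f g                                    ≈⟨ f-cong (λ { zero → ≈-refl ; (suc i) → ≈-refl }) ⟩
    f (updateAt g zero (const (g zero)))   ≲⟨ f-mono g zero (g⊑g′ zero) ⟩
    f (updateAt g zero (const (g′ zero)))  ≈⟨ f-cong (λ { zero → ≈-refl ; (suc i) → ≈-refl }) ⟩
    f′ (Vector.tail g)                     ≲⟨ monotoneInEachArgument⇒monotone (_⊑_ ∘ suc) f′
                                                f′-cong f′-mono (g⊑g′ ∘ suc) ⟩
    f′ (Vector.tail g′)                    ≈⟨ f-cong (λ { zero → ≈-refl ; (suc i) → ≈-refl }) ⟩
    f g′                                   ∎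
    where
    f′ : Vector A n → B
    f′ v = f (g′ zero Vector.∷ v)
    f′-cong : Congruent f′
    f′-cong v≈v′ = f-cong λ { zero → ≈-refl ; (suc i) → v≈v′ i }
    f′-mono : MonotoneInEachArgument (_⊑_ ∘ suc) f′
    f′-mono v j {x} {y} x⊑y = begin
      f′ (updateAt v j (const x))                      ≈⟨ f-cong (λ { zero → ≈-refl ; (suc i) → ≈-refl }) ⟩
      f (updateAt (g′ zero Vector.∷ v) (suc j) (const x)) ≲⟨ f-mono _ (suc j) x⊑y ⟩
      f (updateAt (g′ zero Vector.∷ v) (suc j) (const y)) ≈⟨ f-cong (λ { zero → ≈-refl ; (suc i) → ≈-refl }) ⟩
      f′ (updateAt v j (const y))                      ∎

infixl 10 _^_

-- Carrier and _≈_ are those of L for every s, so L ^ s is usable at an abstract sort s.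
_^_ : ∀ {ℓ : Level} → BoundedLattice ℓ ℓ ℓ → Sort → BoundedLattice ℓ ℓ ℓ
_^_ {ℓ} L s = record
  { _≈_ = _≈_ ; _≤_ = order s ; _∨_ = joinOf L s ; _∧_ = meetOf s ; ⊤ = topOf s ; ⊥ = botOf L s
  ; isBoundedLattice = isBoundedLattice^ s
  }
  where
  open BoundedLattice L
  order : Sort → Rel Carrier ℓ
  order one  = _≤_
  order dual = flip _≤_
  meetOf : Sort → Carrier → Carrier → Carrier
  meetOf one  = _∧_
  meetOf dual = _∨_
  topOf : Sort → Carrier
  topOf one  = ⊤
  topOf dual = ⊥
  isBoundedLattice^ : ∀ s → IsBoundedLattice _≈_ (order s) (joinOf L s) (meetOf s) (topOf s) (botOf L s)
  isBoundedLattice^ one  = isBoundedLattice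
  isBoundedLattice^ dual = record
    { isLattice = ∧-∨-isLattice lattice ; maximum = minimum ; minimum = maximum }

module FilterProperties {ℓ} (M : BoundedLattice ℓ ℓ ℓ) where
  open BoundedLattice M

  ⋀-∈ : ∀ {F} → IsFilter M F → All F ⊆ F ∘ foldr _∧_ ⊤
  ⋀-∈ isF []       = IsFilter.top∈ isF
  ⋀-∈ isF (p ∷ ps) = IsFilter.meet∈ isF p (⋀-∈ isF ps)

  generated-least : ∀ {S F} → IsFilter M F → S ⊆ F → Generated M one S ⊆ F
  generated-least isF S⊆F (_ , S-cs , ⋀cs≤z) = IsFilter.up isF ⋀cs≤z (⋀-∈ isF (All.map S⊆F S-cs))

  ⊆-generated : ∀ {S} → S ⊆ Generated M one S
  ⊆-generated {x = c} Sc = c ∷ [] , Sc ∷ [] , x∧y≤x c ⊤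

module Sorted {ℓ} (L : BoundedLattice ℓ ℓ ℓ) where
  open BoundedLattice L

  _≤[_]_ : Carrier → Sort → Carrier → Set ℓ
  a ≤[ s ] b = BoundedLattice._≤_ (L ^ s) a b

  ideal⇒dualFilter : ∀ {J} → IsIdeal L J → IsFilter (L ^ dual) J
  ideal⇒dualFilter isJ = record { top∈ = bot∈ ; up = down ; meet∈ = join∈ }
    where open IsIdeal isJ

  dualFilter⇒ideal : ∀ {J} → IsFilter (L ^ dual) J → IsIdeal L J
  dualFilter⇒ideal isF = record { bot∈ = top∈ ; down = up ; join∈ = meet∈ }
    where open IsFilter isF

  elemsOf-isFilter : ∀ s (w : Z L s) → IsFilter (L ^ s) (elemsOf L s w)
  elemsOf-isFilter one  (_ , isF) = isF
  elemsOf-isFilter dual (_ , isJ) = ideal⇒dualFilter isJ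

  generated-least : ∀ s {S F} → IsFilter (L ^ s) F → S ⊆ F → Generated L s S ⊆ F
  generated-least one  = FilterProperties.generated-least L
  generated-least dual = FilterProperties.generated-least (L ^ dual)

  ⊆-generated : ∀ s {S} → S ⊆ Generated L s S
  ⊆-generated one  = FilterProperties.⊆-generated L
  ⊆-generated dual = FilterProperties.⊆-generated (L ^ dual)

  ⊆⇒LeqOf : ∀ s {P Q} → P ⊆ Q → LeqOf L s P Q
  ⊆⇒LeqOf one  P⊆Q _ (a , Pa , ya) = a , P⊆Q Pa , ya
  ⊆⇒LeqOf dual P⊆Q _ (a , xa , Pa) = a , xa , P⊆Q Pa

  LeqOf⇒⊆ : ∀ s {P Q} → (∀ {a b} → a ≤[ s ] b → Q a → Q b) → LeqOf L s P Q → P ⊆ Q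
  LeqOf⇒⊆ one Q-up P≤Q {a} Pa =
    let c , Qc , c≤a = P≤Q ↓a (a , Pa , refl) in Q-up c≤a Qc
    where
    ↓a : Ideal L
    ↓a = (_≤ a) , record { bot∈ = minimum a ; down = trans ; join∈ = ∨-least }
  LeqOf⇒⊆ dual Q-up P≤Q {a} Pa =
    let c , a≤c , Qc = P≤Q ↑a (a , refl , Pa) in Q-up a≤c Qc
    where
    ↑a : Filter L
    ↑a = (a ≤_) , record { top∈ = maximum a ; up = flip trans ; meet∈ = ∧-greatest }

  normal⇒monotone : ∀ {d f} → IsNormalOperator L d f →
    ∀ {g g′} → (∀ j → g j ≤[ args d j ] g′ j) → f g ≤[ out d ] f g′
  normal⇒monotone {d} {f} N =
    monotoneInEachArgument⇒monotone setoid (BoundedLattice.preorder (L ^ out d))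
      (λ j → _≤[ args d j ]_) f f-cong f-mono
    where
    open IsNormalOperator N renaming (cong to f-cong)
    open PreorderReasoning (BoundedLattice.preorder (L ^ out d))
    f-mono : MonotoneInEachArgument setoid (BoundedLattice.preorder (L ^ out d)) (λ j → _≤[ args d j ]_) f
    f-mono g j {b} {c} b≤c = begin
      f (updateAt g j (const b))   ≲⟨ BoundedLattice.x≤x∨y (L ^ out d) _ _ ⟩
      joinOf L (out d) (f (updateAt g j (const b))) (f (updateAt g j (const c)))
                                   ≈⟨ Eq.sym (distrib g j b c) ⟩
      f (updateAt g j (const (joinOf L (args d j) b c)))
                                   ≈⟨ f-cong (updateAt-const-cong {R = _≈_} Eq.refl g j
                                        (x≤y⇒x∨y≈y (BoundedLattice.joinSemilattice (L ^ args d j)) b≤c)) ⟩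
      f (updateAt g j (const c))   ∎

record IsBoundedMeetHomomorphism {ℓ} (M N : BoundedLattice ℓ ℓ ℓ)
       (h : BoundedLattice.Carrier M → BoundedLattice.Carrier N) : Set ℓ where
  private
    module M = BoundedLattice M
    module N = BoundedLattice N
  field
    cong   : ∀ {a b} → a M.≈ b → h a N.≈ h b
    ∧-homo : ∀ a b → h (a M.∧ b) N.≈ h a N.∧ h b
    ⊤-homo : h M.⊤ N.≈ N.⊤

  monotone : ∀ {a b} → a M.≤ b → h a N.≤ h b
  monotone {a} {b} a≤b = N.trans
    (N.reflexive (N.Eq.trans (cong (M.Eq.sym (y≤x⇒x∧y≈y M.meetSemilattice a≤b))) (∧-homo b a)))
    (N.x∧y≤x (h b) (h a))

upwardImage : ∀ {ℓ} {A : Set ℓ} (N : BoundedLattice ℓ ℓ ℓ) →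
  (A → BoundedLattice.Carrier N) → Pred A ℓ → Pred (BoundedLattice.Carrier N) ℓ
upwardImage N h F b = ∃ λ a → F a × BoundedLattice._≤_ N (h a) b

module _ {ℓ} {M N : BoundedLattice ℓ ℓ ℓ} {h : BoundedLattice.Carrier M → BoundedLattice.Carrier N}
         (isHom : IsBoundedMeetHomomorphism M N h) where
  private
    module M = BoundedLattice M
    module N = BoundedLattice N
  open IsBoundedMeetHomomorphism isHom

  preimage-isFilter : ∀ {F} → IsFilter N F → IsFilter M (F ∘ h)
  preimage-isFilter isF = record
    { top∈  = up (N.reflexive (N.Eq.sym ⊤-homo)) top∈
    ; up    = up ∘ monotone
    ; meet∈ = λ Fha Fhb → up (N.reflexive (N.Eq.sym (∧-homo _ _))) (meet∈ Fha Fhb)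
    }
    where open IsFilter isF

  upwardImage-isFilter : ∀ {F} → IsFilter M F → IsFilter N (upwardImage N h F)
  upwardImage-isFilter isF = record
    { top∈  = M.⊤ , top∈ , N.maximum _
    ; up    = λ { b≤c (a , Fa , ha≤b) → a , Fa , N.trans ha≤b b≤c }
    ; meet∈ = λ { (a , Fa , ha≤b) (a′ , Fa′ , ha′≤b′) →
        a M.∧ a′ , meet∈ Fa Fa′ ,
        N.trans (N.reflexive (∧-homo a a′)) (N.∧-greatest
          (N.trans (N.x∧y≤x _ _) ha≤b) (N.trans (N.x∧y≤y _ _) ha′≤b′)) }
    }
    where open IsFilter isF

  ⊆-upwardImage : ∀ {F} → F ⊆ upwardImage N h F ∘ h
  ⊆-upwardImage Fa = _ , Fa , N.refl

module _ {k ℓ} {K : Set k} {τ : K → DType} {L L* : NLE τ ℓ} (h : Hom L L*) where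
  private
    module ℒ = BoundedLattice (lat L)
    module ℒ* = BoundedLattice (lat L*)
    module S = Sorted (lat L)
    module S* = Sorted (lat L*)

  isHomomorphism^ : ∀ s → IsBoundedMeetHomomorphism (lat L ^ s) (lat L* ^ s) (fun h)
  isHomomorphism^ one  = record { cong = Hom.cong h ; ∧-homo = pres-∧ h ; ⊤-homo = pres-⊤ h }
  isHomomorphism^ dual = record { cong = Hom.cong h ; ∧-homo = pres-∨ h ; ⊤-homo = pres-⊥ h }

  πmap-isFilter : ∀ s (w : Z (lat L*) s) → IsFilter (lat L ^ s) (πmap h s w)
  πmap-isFilter s w = preimage-isFilter (isHomomorphism^ s) (S*.elemsOf-isFilter s w)

  upwardImageᶻ : ∀ s (u : Z (lat L) s) → Σ (Z (lat L*) s) λ w →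
    elemsOf (lat L) s u ⊆ πmap h s w
    × elemsOf (lat L*) s w ⊆ upwardImage (lat L* ^ s) (fun h) (elemsOf (lat L) s u)
  upwardImageᶻ one (_ , isF) =
    (_ , upwardImage-isFilter (isHomomorphism^ one) isF) , ⊆-upwardImage (isHomomorphism^ one) , id
  upwardImageᶻ dual (_ , isJ) =
    (_ , S*.dualFilter⇒ideal (upwardImage-isFilter (isHomomorphism^ dual) (S.ideal⇒dualFilter isJ))) ,
    ⊆-upwardImage (isHomomorphism^ dual) , id

  preimage-Irel : ∀ (x' : Filter (lat L*)) (y' : Ideal (lat L*)) →
    Irel (lat L*) (elemsOf (lat L*) one x') (elemsOf (lat L*) dual y') →
    Irel (lat L) (preimage h (elemsOf (lat L*) one x')) (preimage h (elemsOf (lat L*) dual y'))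
  preimage-Irel _ _ x'∩y'=∅ a = x'∩y'=∅ (fun h a)

  filter-lift : ∀ (x : Filter (lat L)) (y' : Ideal (lat L*)) →
    Irel (lat L) (elemsOf (lat L) one x) (preimage h (elemsOf (lat L*) dual y')) →
    Σ (Filter (lat L*)) λ x' →
      LeqOf (lat L) one (elemsOf (lat L) one x) (preimage h (elemsOf (lat L*) one x'))
      × Irel (lat L*) (elemsOf (lat L*) one x') (elemsOf (lat L*) dual y')
  filter-lift x (_ , isJ) x∩qy'=∅ =
    let x' , x⊆px' , x'⊆↑hx = upwardImageᶻ one x in
    x' , S.⊆⇒LeqOf one x⊆px' , λ b x'b y'b →
      let a , xa , ha≤b = x'⊆↑hx x'b in x∩qy'=∅ a xa (IsIdeal.down isJ ha≤b y'b)

  ideal-lift : ∀ (x' : Filter (lat L*)) (y : Ideal (lat L)) →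
    Irel (lat L) (preimage h (elemsOf (lat L*) one x')) (elemsOf (lat L) dual y) →
    Σ (Ideal (lat L*)) λ y' →
      LeqOf (lat L) dual (elemsOf (lat L) dual y) (preimage h (elemsOf (lat L*) dual y'))
      × Irel (lat L*) (elemsOf (lat L*) one x') (elemsOf (lat L*) dual y')
  ideal-lift (_ , isF) y px'∩y=∅ =
    let y' , y⊆qy' , y'⊆↓hy = upwardImageᶻ dual y in
    y' , S.⊆⇒LeqOf dual y⊆qy' , λ b x'b y'b →
      let a , ya , b≤ha = y'⊆↓hy y'b in px'∩y=∅ a (IsFilter.up isF b≤ha x'b) ya

  module _ (σ : K) where
    private
      d = τ σ

    CanR-πmap⇒lift : ∀ (u : (j : Fin (arity d)) → Z (lat L) (args d j)) (v : Z (lat L*) (out d)) →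
      CanR (lat L) d (op L σ) (πmap h (out d) v) u →
      Σ ((j : Fin (arity d)) → Z (lat L*) (args d j)) λ w →
        (∀ j → LeqOf (lat L) (args d j) (elemsOf (lat L) (args d j) (u j)) (πmap h (args d j) (w j)))
        × CanR (lat L*) d (op L* σ) (elemsOf (lat L*) (out d) v) w
    CanR-πmap⇒lift u v fhat[u]⊆πv =
      w , (λ j → S.⊆⇒LeqOf (args d j) (u⊆πw j)) ,
      λ _ → S*.generated-least (out d) v-isFilter f*[w]⊆v
      where
      w : ∀ j → Z (lat L*) (args d j)
      w j = proj₁ (upwardImageᶻ (args d j) (u j))
      u⊆πw : ∀ j → elemsOf (lat L) (args d j) (u j) ⊆ πmap h (args d j) (w j)
      u⊆πw j = proj₁ (proj₂ (upwardImageᶻ (args d j) (u j)))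
      w⊆↑hu : ∀ j → elemsOf (lat L*) (args d j) (w j)
                  ⊆ upwardImage (lat L* ^ args d j) (fun h) (elemsOf (lat L) (args d j) (u j))
      w⊆↑hu j = proj₂ (proj₂ (upwardImageᶻ (args d j) (u j)))
      v-isFilter : IsFilter (lat L* ^ out d) (elemsOf (lat L*) (out d) v)
      v-isFilter = S*.elemsOf-isFilter (out d) v
      f*[w]⊆v : ∀ {c} → (Σ (Fin (arity d) → ℒ*.Carrier) λ b →
        (∀ j → elemsOf (lat L*) (args d j) (w j) (b j)) × c ≡ op L* σ b) → elemsOf (lat L*) (out d) v c
      f*[w]⊆v (b , b∈w , ≡.refl) = IsFilter.up v-isFilter
        (S*.normal⇒monotone (isNormal L* σ) (λ j → proj₂ (proj₂ (below j))))
        (IsFilter.up v-isFilter (BoundedLattice.reflexive (lat L* ^ out d) (pres-op h σ a))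
          (fhat[u]⊆πv _ (S.⊆-generated (out d) (a , (λ j → proj₁ (proj₂ (below j))) , ≡.refl))))
        where
        below : ∀ j → upwardImage (lat L* ^ args d j) (fun h) (elemsOf (lat L) (args d j) (u j)) (b j)
        below j = w⊆↑hu j (b∈w j)
        a : Fin (arity d) → ℒ.Carrier
        a j = proj₁ (below j)

    lift⇒CanR-πmap : ∀ (u : (j : Fin (arity d)) → Z (lat L) (args d j)) (v : Z (lat L*) (out d)) →
      Σ ((j : Fin (arity d)) → Z (lat L*) (args d j)) (λ w →
        (∀ j → LeqOf (lat L) (args d j) (elemsOf (lat L) (args d j) (u j)) (πmap h (args d j) (w j)))
        × CanR (lat L*) d (op L* σ) (elemsOf (lat L*) (out d) v) w) →
      CanR (lat L) d (op L σ) (πmap h (out d) v) u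
    lift⇒CanR-πmap u v (w , u≤πw , fhat*[w]⊆v) _ =
      S.generated-least (out d) (πmap-isFilter (out d) v) f[u]⊆πv
      where
      f[u]⊆πv : ∀ {c} → (Σ (Fin (arity d) → ℒ.Carrier) λ a →
        (∀ j → elemsOf (lat L) (args d j) (u j) (a j)) × c ≡ op L σ a) → πmap h (out d) v c
      f[u]⊆πv (a , a∈u , ≡.refl) = IsFilter.up (S*.elemsOf-isFilter (out d) v)
        (BoundedLattice.reflexive (lat L* ^ out d) (ℒ*.Eq.sym (pres-op h σ a)))
        (fhat*[w]⊆v _ (S*.⊆-generated (out d) (fun h ∘ a , ha∈w , ≡.refl)))
        where
        ha∈w : ∀ j → elemsOf (lat L*) (args d j) (w j) (fun h (a j))
        ha∈w j = S.LeqOf⇒⊆ (args d j) (IsFilter.up (πmap-isFilter (args d j) (w j))) (u≤πw j) (a∈u j)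

proposition4p6 : ∀ {k ℓ : Level} {K : Set k} (τ : K → DType)
    (L L* : NLE τ ℓ) (h : Hom L L*) →
    -- π = (p,q) maps X* → X and Y* → Y
    (∀ (x' : Filter (lat L*)) → IsFilter (lat L) (preimage h (elemsOf (lat L*) one x')))
    × (∀ (y' : Ideal (lat L*)) → IsIdeal (lat L) (preimage h (elemsOf (lat L*) dual y')))
    -- (MAx1)
    × (∀ (x' : Filter (lat L*)) (y' : Ideal (lat L*)) →
         Irel (lat L*) (elemsOf (lat L*) one x') (elemsOf (lat L*) dual y') →
         Irel (lat L) (preimage h (elemsOf (lat L*) one x'))
                      (preimage h (elemsOf (lat L*) dual y')))
    -- (MAx2)
    × (∀ (x : Filter (lat L)) (y' : Ideal (lat L*)) →
         Irel (lat L) (elemsOf (lat L) one x) (preimage h (elemsOf (lat L*) dual y')) →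
         Σ (Filter (lat L*)) λ x' →
           LeqOf (lat L) one (elemsOf (lat L) one x) (preimage h (elemsOf (lat L*) one x'))
           × Irel (lat L*) (elemsOf (lat L*) one x') (elemsOf (lat L*) dual y'))
    -- (MAx3)
    × (∀ (x' : Filter (lat L*)) (y : Ideal (lat L)) →
         Irel (lat L) (preimage h (elemsOf (lat L*) one x')) (elemsOf (lat L) dual y) →
         Σ (Ideal (lat L*)) λ y' →
           LeqOf (lat L) dual (elemsOf (lat L) dual y) (preimage h (elemsOf (lat L*) dual y'))
           × Irel (lat L*) (elemsOf (lat L*) one x') (elemsOf (lat L*) dual y'))
    -- (MAx4)
    × (∀ (σ : K) (u : (j : Fin (arity (τ σ))) → Z (lat L) (args (τ σ) j))
         (v : Z (lat L*) (out (τ σ))) →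
         CanR (lat L) (τ σ) (op L σ) (πmap h (out (τ σ)) v) u
         ⇔ Σ ((j : Fin (arity (τ σ))) → Z (lat L*) (args (τ σ) j)) λ w →
             (∀ j → LeqOf (lat L) (args (τ σ) j)
                      (elemsOf (lat L) (args (τ σ) j) (u j))
                      (πmap h (args (τ σ) j) (w j)))
             × CanR (lat L*) (τ σ) (op L* σ) (elemsOf (lat L*) (out (τ σ)) v) w)
proposition4p6 τ L L* h =
  πmap-isFilter h one ,
  (λ y' → Sorted.dualFilter⇒ideal (lat L) (πmap-isFilter h dual y')) ,
  preimage-Irel h ,
  filter-lift h ,
  ideal-lift h ,
  λ σ u v → mk⇔ (CanR-πmap⇒lift h σ u v) (lift⇒CanR-πmap h σ u v)
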